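{- Let $r\geq4$, let $G$ be an extraspecial $2$-group of order $2^{2r+1}$ with centre $Z$, suppose $\{Zg_1,\ldots,Zg_{2r}\}$ ($g_i\in G$) is a symmetric basis of $G/Z$ with respect to the quadratic form $Q(Zx)=x^2$, let $S=\{g_1,\ldots,g_{2r}\}$, $\Gamma=\mathrm{Cay}(G,S)$ and $A=\mathrm{Aut}(\Gamma)$. Let $\rho\in A$ fix the vertex $\mathbf 1$ and every vertex in its neighbourhood $N(\mathbf 1)=S$. Then for every $v\in N(\mathbf 1)$, $\rho$ fixes $v$ and every neighbour of $v$.
   Context: An extraspecial $2$-group of order $2^{2r+1}$ is a $2$-group $G$ with $|Z(G)|=2$ and $G/Z(G)\cong\mathbb{Z}_2^{2r}$. Identifying $Z$ with $\mathbb{F}_2$, $Q(Zx)=x^2$ is a quadratic form on $G/Z$ with associated bilinear form $B(Zx,Zy)=[x,y]$. A basis is symmetric if $Q(v_i)=0$ for all $i$ and $B(v_i,v_j)=1$ for $i<j$. $\mathrm{Cay}(G,S)$ has vertex set $G$ and edges $\{x,sx\}$, $x\in G$, $s\in S$. -}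

module Defs where

open import Level using (0ℓ)
open import Data.Nat using (ℕ; zero; suc; _+_; _*_; _^_)
open import Data.Fin using (Fin; zero; suc)
open import Data.Bool using (Bool; true; false; if_then_else_; _xor_)
open import Data.Vec using (Vec; zipWith; replicate)
open import Data.Product using (Σ; ∃; ∃-syntax; _×_; _,_)
open import Data.Sum using (_⊎_)
open import Relation.Nullary using (¬_)
open import Relation.Binary.PropositionalEquality as ≡ using (_≡_)
open import Function using (_∘_)
open import Function.Bundles using (Inverse)
open import Algebra.Bundles using (Group)

module _ (G : Group 0ℓ 0ℓ) where
  open Group G

  [_,_] : Carrier → Carrier → Carrier
  [ x , y ] = ((x ⁻¹ ∙ y ⁻¹) ∙ x) ∙ y

  IsCentral : Carrier → Set
  IsCentral x = ∀ y → x ∙ y ≈ y ∙ x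

  HasOrder : ℕ → Set
  HasOrder m = Inverse (≡.setoid (Fin m)) setoid

  CentreIs : Carrier → Set
  CentreIs z = IsCentral z × ¬ (z ≈ ε) × (∀ x → IsCentral x → x ≈ ε ⊎ x ≈ z)

  InZ : Carrier → Carrier → Set
  InZ z x = x ≈ ε ⊎ x ≈ z

  -- G/Z ≅ ℤ₂ⁿ, expressed (first isomorphism theorem) as a surjective
  -- homomorphism φ : G → ℤ₂ⁿ (componentwise xor) with kernel exactly Z
  QuotientIsoZ2^ : Carrier → ℕ → Set
  QuotientIsoZ2^ z n =
    Σ (Carrier → Vec Bool n) λ φ →
      (∀ x y → x ≈ y → φ x ≡ φ y) ×
      (∀ x y → φ (x ∙ y) ≡ zipWith _xor_ (φ x) (φ y)) ×
      (∀ v → ∃ λ x → φ x ≡ v) ×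
      (∀ x → (φ x ≡ replicate n false → InZ z x) × (InZ z x → φ x ≡ replicate n false))

  IsExtraspecial2 : ℕ → Carrier → Set
  IsExtraspecial2 r z =
    HasOrder (2 ^ (2 * r + 1)) × CentreIs z × QuotientIsoZ2^ z (2 * r)

  prodSub : ∀ {n} → (Fin n → Carrier) → (Fin n → Bool) → Carrier
  prodSub {zero}  g T = ε
  prodSub {suc n} g T =
    (if T zero then g zero else ε) ∙ prodSub (g ∘ suc) (T ∘ suc)

  -- {Z g i} is a basis of the 𝔽₂-vector space G/Z (written additively:
  -- the vector Σ_{i∈T} Z g i is the coset Z ∏_{i∈T} g i)
  IsBasisModZ : ∀ {n} → Carrier → (Fin n → Carrier) → Set
  IsBasisModZ z g =
    (∀ x → ∃ λ T → ∃ λ c → InZ z c × x ≈ c ∙ prodSub g T) ×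
    (∀ T → InZ z (prodSub g T) → ∀ i → T i ≡ false)

  -- symmetric basis w.r.t. Q(Zx) = x² and B(Zx,Zy) = [x,y], Z ≅ 𝔽₂ via ε ↦ 0, z ↦ 1
  IsSymmetricBasis : ∀ {n} → Carrier → (Fin n → Carrier) → Set
  IsSymmetricBasis {n} z g =
    IsBasisModZ z g ×
    (∀ i → g i ∙ g i ≈ ε) ×
    (∀ (i j : Fin n) → Data.Fin._<_ i j → [ g i , g j ] ≈ z)

  CayAdj : ∀ {n} → (Fin n → Carrier) → Carrier → Carrier → Set
  CayAdj g x y = ∃ λ i → (y ≈ g i ∙ x) ⊎ (x ≈ g i ∙ y)

  IsCayAut : ∀ {n} → (Fin n → Carrier) → Inverse setoid setoid → Set
  IsCayAut g ρ = ∀ x y →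
    (CayAdj g x y → CayAdj g (Inverse.to ρ x) (Inverse.to ρ y)) ×
    (CayAdj g (Inverse.to ρ x) (Inverse.to ρ y) → CayAdj g x y)

module Submission where

open import Defs
open import Level using (0ℓ)
open import Data.Nat using (ℕ; _≤_; _*_; _<_)
open import Data.Fin using (Fin)
open import Data.Product using (_×_; ∃; ∃₂; _,_; proj₁; map₂)
open import Function.Bundles using (Inverse; Injection)
open import Algebra.Bundles using (Group)

import Data.Nat.Properties as ℕ
open import Data.Fin.Properties using (_≟_; <-cmp; <⇒≢; pigeonhole; ¬∀⟶∃¬)
open import Data.Bool using (Bool; true; false; _xor_)
open import Data.Sum using (_⊎_; inj₁; inj₂; swap)
open import Data.Empty using (⊥; ⊥-elim)
open import Data.List using (List; []; _∷_; length)
open import Data.List.Relation.Unary.All using (All; []; _∷_)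
open import Data.List.Relation.Unary.All.Properties using (¬Any⇒All¬)
open import Data.List.Relation.Unary.Any using (index)
open import Data.List.Membership.Propositional using (_∈_)
open import Data.List.Membership.Setoid.Properties using (index-injective)
open import Function using (_∘_; case_of_)
open import Function.Properties.Inverse using (Inverse⇒Injection)
open import Relation.Binary using (tri<; tri≈; tri>)
open import Relation.Binary.PropositionalEquality as ≡ using (_≡_; _≢_; refl; ≢-sym)
open import Relation.Nullary using (¬_; yes; no)
open import Relation.Nullary.Decidable using (decidable-stable)
open import Tactic.MonoidSolver using (solve)

-- The elements of a symmetric basis lift to involutions g₁, …, gₙ that pairwise
-- anticommute, gᵢ gⱼ = z gⱼ gᵢ.  The commutator with g_t of a word in the gᵢ
-- records the parity of the number of letters different from t, and this is
-- enough to show that g_k g_i and g_l g_j have no common neighbour when k, i, l, j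
-- are distinct.
-- A ρ fixing 1 and S maps g_j g_i, a neighbour of g_i, to some g_k g_i.  If
-- k ≠ j, then for every a ∉ {i, j} the vertex g_a g_j g_i = g_i g_a g_j is a
-- common neighbour of g_j g_i and g_a g_j, so ρ(g_a g_j) = g_l g_j with
-- l ∈ {k, i}.  As a ↦ l is injective, n ≥ 5 leaves room for three such a, and
-- two of them collide.

fresh : ∀ {n} (xs : List (Fin n)) → length xs < n → ∃ λ a → All (a ≢_) xs
fresh {n} xs |xs|<n = map₂ (¬Any⇒All¬ xs) (¬∀⟶∃¬ n (_∈ xs) (_∈? xs) not-all-in)
  where
  open import Data.List.Membership.DecPropositional (_≟_ {n}) using (_∈?_)
  not-all-in : ¬ (∀ a → a ∈ xs)
  not-all-in all∈ with pigeonhole |xs|<n (index ∘ all∈)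
  ... | a , b , a<b , same-index =
    <⇒≢ a<b (index-injective (≡.setoid _) (all∈ a) (all∈ b) same-index)

pigeonhole-pair : ∀ {A : Set} {x y a b c : A} → a ≢ b → a ≢ c → b ≢ c →
  a ≡ x ⊎ a ≡ y → b ≡ x ⊎ b ≡ y → c ≡ x ⊎ c ≡ y → ⊥
pigeonhole-pair a≢b _   _   (inj₁ refl) (inj₁ refl) _           = a≢b refl
pigeonhole-pair a≢b _   _   (inj₂ refl) (inj₂ refl) _           = a≢b refl
pigeonhole-pair _   a≢c _   (inj₁ refl) (inj₂ refl) (inj₁ refl) = a≢c refl
pigeonhole-pair _   _   b≢c (inj₁ refl) (inj₂ refl) (inj₂ refl) = b≢c refl
pigeonhole-pair _   _   b≢c (inj₂ refl) (inj₁ refl) (inj₁ refl) = b≢c refl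
pigeonhole-pair _   a≢c _   (inj₂ refl) (inj₁ refl) (inj₂ refl) = a≢c refl

no-injection-into-pair : ∀ {n} {B : Set} {x y : B} (P : Fin n → B → Set) →
  5 ≤ n → (i j : Fin n) →
  (∀ {a} → a ≢ i → a ≢ j → ∃ λ l → P a l × (l ≡ x ⊎ l ≡ y)) →
  (∀ {a b l} → P a l → P b l → a ≡ b) → ⊥
-- 5 ≤ n unfolds to 4 < n, hence 3 < n and 2 < n.
no-injection-into-pair P 5≤n i j image injective
  with fresh (i ∷ j ∷ []) (ℕ.<⇒≤ (ℕ.<⇒≤ 5≤n))
... | a , a≢i ∷ a≢j ∷ [] with fresh (a ∷ i ∷ j ∷ []) (ℕ.<⇒≤ 5≤n)
... | b , b≢a ∷ b≢i ∷ b≢j ∷ [] with fresh (b ∷ a ∷ i ∷ j ∷ []) 5≤n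
... | c , c≢b ∷ c≢a ∷ c≢i ∷ c≢j ∷ []
  with image a≢i a≢j | image b≢i b≢j | image c≢i c≢j
... | la , Pa , la∈ | lb , Pb , lb∈ | lc , Pc , lc∈ =
  pigeonhole-pair (distinct b≢a Pa Pb) (distinct c≢a Pa Pc) (distinct c≢b Pb Pc) la∈ lb∈ lc∈
  where
  distinct : ∀ {a b la lb} → b ≢ a → P a la → P b lb → la ≢ lb
  distinct b≢a Pa Pb refl = b≢a (injective Pb Pa)

module _ (G : Group 0ℓ 0ℓ) where
  open Group G renaming (refl to ≈-refl)
  open import Algebra.Properties.Group G
    using (∙-cancelʳ; inverseˡ-unique; ⁻¹-anti-homo-∙; ⁻¹-involutive; ⁻¹-injective; ε⁻¹≈ε)
  open import Relation.Binary.Reasoning.Setoid setoid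

  ⁻¹-central : ∀ {x} → IsCentral G x → IsCentral G (x ⁻¹)
  ⁻¹-central {x} x-central y = begin
    x ⁻¹ ∙ y          ≈⟨ ∙-congˡ (sym (⁻¹-involutive y)) ⟩
    x ⁻¹ ∙ y ⁻¹ ⁻¹    ≈⟨ sym (⁻¹-anti-homo-∙ (y ⁻¹) x) ⟩
    (y ⁻¹ ∙ x) ⁻¹     ≈⟨ ⁻¹-cong (sym (x-central (y ⁻¹))) ⟩
    (x ∙ y ⁻¹) ⁻¹     ≈⟨ ⁻¹-anti-homo-∙ x (y ⁻¹) ⟩
    y ⁻¹ ⁻¹ ∙ x ⁻¹    ≈⟨ ∙-congʳ (⁻¹-involutive y) ⟩
    y ∙ x ⁻¹          ∎

  centre-involution : ∀ {z} → CentreIs G z → z ∙ z ≈ ε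
  centre-involution {z} (z-central , z≉ε , Z⊆ε,z) with Z⊆ε,z (z ⁻¹) (⁻¹-central z-central)
  ... | inj₁ z⁻¹≈ε = ⊥-elim (z≉ε (⁻¹-injective (trans z⁻¹≈ε (sym ε⁻¹≈ε))))
  ... | inj₂ z⁻¹≈z = trans (∙-congˡ (sym z⁻¹≈z)) (inverseʳ z)

  involutions-anticommute : ∀ {x y c} → x ∙ x ≈ ε → y ∙ y ≈ ε →
    [_,_] G x y ≈ c → x ∙ y ≈ c ∙ (y ∙ x)
  involutions-anticommute {x} {y} {c} x²≈ε y²≈ε [x,y]≈c = begin
    x ∙ y                               ≈⟨ sym (identityʳ _) ⟩
    (x ∙ y) ∙ ε                         ≈⟨ ∙-congˡ (sym x²≈ε) ⟩
    (x ∙ y) ∙ (x ∙ x)                   ≈⟨ ∙-congˡ (∙-congˡ (sym (identityˡ x))) ⟩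
    (x ∙ y) ∙ (x ∙ (ε ∙ x))             ≈⟨ ∙-congˡ (∙-congˡ (∙-congʳ (sym y²≈ε))) ⟩
    (x ∙ y) ∙ (x ∙ ((y ∙ y) ∙ x))       ≈⟨ solve monoid ⟩
    (((x ∙ y) ∙ x) ∙ y) ∙ (y ∙ x)       ≈⟨ ∙-congʳ (∙-congʳ (∙-congʳ (∙-cong x≈x⁻¹ y≈y⁻¹))) ⟩
    (((x ⁻¹ ∙ y ⁻¹) ∙ x) ∙ y) ∙ (y ∙ x) ≈⟨ ∙-congʳ [x,y]≈c ⟩
    c ∙ (y ∙ x)                         ∎
    where
    x≈x⁻¹ = inverseˡ-unique x x x²≈ε
    y≈y⁻¹ = inverseˡ-unique y y y²≈ε

  anticommute-sym : ∀ {x y z} → z ∙ z ≈ ε → x ∙ y ≈ z ∙ (y ∙ x) → y ∙ x ≈ z ∙ (x ∙ y)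
  anticommute-sym {x} {y} {z} z²≈ε xy≈zyx = begin
    y ∙ x              ≈⟨ sym (identityˡ _) ⟩
    ε ∙ (y ∙ x)        ≈⟨ ∙-congʳ (sym z²≈ε) ⟩
    (z ∙ z) ∙ (y ∙ x)  ≈⟨ assoc z z _ ⟩
    z ∙ (z ∙ (y ∙ x))  ≈⟨ ∙-congˡ (sym xy≈zyx) ⟩
    z ∙ (x ∙ y)        ∎

  symmetric-basis-anticommutes : ∀ {n z} {g : Fin n → Carrier} → z ∙ z ≈ ε →
    IsSymmetricBasis G z g → ∀ {i j} → i ≢ j → g i ∙ g j ≈ z ∙ (g j ∙ g i)
  symmetric-basis-anticommutes z²≈ε (_ , g²≈ε , [gᵢ,gⱼ]≈z) {i} {j} i≢j with <-cmp i j
  ... | tri< i<j _ _ = involutions-anticommute (g²≈ε i) (g²≈ε j) ([gᵢ,gⱼ]≈z i j i<j)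
  ... | tri≈ _ i≡j _ = ⊥-elim (i≢j i≡j)
  ... | tri> _ _ j<i = anticommute-sym z²≈ε
                         (involutions-anticommute (g²≈ε j) (g²≈ε i) ([gᵢ,gⱼ]≈z j i j<i))

  module AnticommutingInvolutions
    {z : Carrier} (z-central : IsCentral G z) (z≉ε : ¬ z ≈ ε) (z²≈ε : z ∙ z ≈ ε)
    {n : ℕ} (g : Fin n → Carrier) (g²≈ε : ∀ i → g i ∙ g i ≈ ε)
    (g-anticommute : ∀ {i j} → i ≢ j → g i ∙ g j ≈ z ∙ (g j ∙ g i)) where

    z^_ : Bool → Carrier
    z^ false = ε
    z^ true  = z

    z^-central : ∀ p y → z^ p ∙ y ≈ y ∙ z^ p
    z^-central false y = trans (identityˡ y) (sym (identityʳ y))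
    z^-central true  y = z-central y

    z^-xor : ∀ p q → z^ p ∙ z^ q ≈ z^ (p xor q)
    z^-xor false q     = identityˡ (z^ q)
    z^-xor true  false = identityʳ z
    z^-xor true  true  = z²≈ε

    z^-injective : ∀ {p q} → z^ p ≈ z^ q → p ≡ q
    z^-injective {false} {false} _   = refl
    z^-injective {true}  {true}  _   = refl
    z^-injective {false} {true}  ε≈z = ⊥-elim (z≉ε (sym ε≈z))
    z^-injective {true}  {false} z≈ε = ⊥-elim (z≉ε z≈ε)

    record Commutes (t : Fin n) (w : Carrier) (p : Bool) : Set where
      constructor commutes
      field swap-gen : g t ∙ w ≈ z^ p ∙ (w ∙ g t)
    open Commutes

    commutes-self : ∀ t → Commutes t (g t) false
    commutes-self t = commutes (sym (identityˡ _))

    commutes-other : ∀ {t a} → t ≢ a → Commutes t (g a) true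
    commutes-other t≢a = commutes (g-anticommute t≢a)

    commutes-∙ : ∀ {t x y p q} → Commutes t x p → Commutes t y q → Commutes t (x ∙ y) (p xor q)
    commutes-∙ {t} {x} {y} {p} {q} (commutes tx) (commutes ty) = commutes (begin
      g t ∙ (x ∙ y)                   ≈⟨ sym (assoc _ _ _) ⟩
      (g t ∙ x) ∙ y                   ≈⟨ ∙-congʳ tx ⟩
      (z^ p ∙ (x ∙ g t)) ∙ y          ≈⟨ solve monoid ⟩
      z^ p ∙ (x ∙ (g t ∙ y))          ≈⟨ ∙-congˡ (∙-congˡ ty) ⟩
      z^ p ∙ (x ∙ (z^ q ∙ (y ∙ g t))) ≈⟨ solve monoid ⟩
      z^ p ∙ ((x ∙ z^ q) ∙ (y ∙ g t)) ≈⟨ ∙-congˡ (∙-congʳ (sym (z^-central q x))) ⟩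
      z^ p ∙ ((z^ q ∙ x) ∙ (y ∙ g t)) ≈⟨ solve monoid ⟩
      (z^ p ∙ z^ q) ∙ ((x ∙ y) ∙ g t) ≈⟨ ∙-congʳ (z^-xor p q) ⟩
      z^ (p xor q) ∙ ((x ∙ y) ∙ g t)  ∎)

    commutes-resp : ∀ {t x y p} → x ≈ y → Commutes t x p → Commutes t y p
    commutes-resp x≈y (commutes tx) =
      commutes (trans (∙-congˡ (sym x≈y)) (trans tx (∙-congˡ (∙-congʳ x≈y))))

    commutes-unique : ∀ {t w p q} → Commutes t w p → Commutes t w q → p ≡ q
    commutes-unique {t} {w} (commutes tw) (commutes tw′) =
      z^-injective (∙-cancelʳ (w ∙ g t) _ _ (trans (sym tw) tw′))

    g-injective : ∀ {a b} → g a ≈ g b → a ≡ b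
    g-injective {a} {b} ga≈gb = decidable-stable (a ≟ b) λ a≢b →
      case commutes-unique (commutes-resp ga≈gb (commutes-self a)) (commutes-other a≢b) of λ ()

    leading-letter : ∀ {t c c′ u u′} → Commutes t u true → Commutes t u′ false →
      g c ∙ u ≈ g c′ ∙ u′ → t ≡ c ⊎ t ≡ c′
    leading-letter {t} {c} {c′} tu tu′ cu≈c′u′ with t ≟ c | t ≟ c′
    ... | yes t≡c | _        = inj₁ t≡c
    ... | no _    | yes t≡c′ = inj₂ t≡c′
    ... | no t≢c  | no t≢c′  with () ← commutes-unique
          (commutes-resp cu≈c′u′ (commutes-∙ (commutes-other t≢c) tu))
          (commutes-∙ (commutes-other t≢c′) tu′)

    no-common-neighbour : ∀ {k i l j} → k ≢ i → k ≢ j → k ≢ l → i ≢ j → i ≢ l → l ≢ j →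
      ¬ ∃₂ λ c c′ → g c ∙ (g k ∙ g i) ≈ g c′ ∙ (g l ∙ g j)
    -- Each of the distinct letters k, i, l has to be one of the two leading letters.
    no-common-neighbour {k} {i} {l} k≢i k≢j k≢l i≢j i≢l l≢j (_ , _ , common) =
      pigeonhole-pair k≢i k≢l i≢l
        (leading-letter (commutes-∙ (commutes-self k) (commutes-other k≢i))
                        (commutes-∙ (commutes-other k≢l) (commutes-other k≢j)) common)
        (leading-letter (commutes-∙ (commutes-other (≢-sym k≢i)) (commutes-self i))
                        (commutes-∙ (commutes-other i≢l) (commutes-other i≢j)) common)
        (swap (leading-letter (commutes-∙ (commutes-self l) (commutes-other l≢j))
                              (commutes-∙ (commutes-other (≢-sym k≢l)) (commutes-other (≢-sym i≢l)))
                              (sym common)))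

    adj⇒left-multiple : ∀ {x y} → CayAdj G g x y → ∃ λ i → y ≈ g i ∙ x
    adj⇒left-multiple (i , inj₁ y≈gᵢx) = i , y≈gᵢx
    adj⇒left-multiple {x} {y} (i , inj₂ x≈gᵢy) = i , (begin
      y                ≈⟨ sym (identityˡ y) ⟩
      ε ∙ y            ≈⟨ ∙-congʳ (sym (g²≈ε i)) ⟩
      (g i ∙ g i) ∙ y  ≈⟨ assoc _ _ _ ⟩
      g i ∙ (g i ∙ y)  ≈⟨ ∙-congˡ (sym x≈gᵢy) ⟩
      g i ∙ x          ∎)

    module FixingGenerators
      (ρ : Inverse setoid setoid) (ρ-aut : IsCayAut G g ρ)
      (ρε≈ε : Inverse.to ρ ε ≈ ε) (ρg≈g : ∀ i → Inverse.to ρ (g i) ≈ g i) where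
      open Inverse ρ using (to; to-cong)

      to-injective : ∀ {x y} → to x ≈ to y → x ≈ y
      to-injective = Injection.injective (Inverse⇒Injection ρ)

      to-adj : ∀ {x y} → CayAdj G g x y → ∃ λ c → to y ≈ g c ∙ to x
      to-adj x~y = adj⇒left-multiple (proj₁ (ρ-aut _ _) x~y)

      to-common-neighbour : ∀ {x y w x′ y′} → CayAdj G g x w → CayAdj G g y w →
        to x ≈ x′ → to y ≈ y′ → ∃₂ λ c c′ → g c ∙ x′ ≈ g c′ ∙ y′
      to-common-neighbour {x} {y} {w} {x′} {y′} x~w y~w ρx≈x′ ρy≈y′
        with to-adj x~w | to-adj y~w
      ... | c , ρw≈cρx | c′ , ρw≈c′ρy = c , c′ , (begin
        g c ∙ x′     ≈⟨ ∙-congˡ (sym ρx≈x′) ⟩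
        g c ∙ to x   ≈⟨ sym ρw≈cρx ⟩
        to w         ≈⟨ ρw≈c′ρy ⟩
        g c′ ∙ to y  ≈⟨ ∙-congˡ ρy≈y′ ⟩
        g c′ ∙ y′    ∎)

      to-square : ∀ i → to (g i ∙ g i) ≈ g i ∙ g i
      to-square i = trans (to-cong (g²≈ε i)) (trans ρε≈ε (sym (g²≈ε i)))

      to-neighbour-of-generator : ∀ i j → ∃ λ k → to (g j ∙ g i) ≈ g k ∙ g i
      to-neighbour-of-generator i j with to-adj {g i} (j , inj₁ ≈-refl)
      ... | k , ρgⱼgᵢ≈gₖρgᵢ = k , trans ρgⱼgᵢ≈gₖρgᵢ (∙-congˡ (ρg≈g i))

      first-letter-injective : ∀ {a b j l} →
        to (g a ∙ g j) ≈ g l ∙ g j → to (g b ∙ g j) ≈ g l ∙ g j → a ≡ b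
      first-letter-injective ρaj≈lj ρbj≈lj =
        g-injective (∙-cancelʳ _ _ _ (to-injective (trans ρaj≈lj (sym ρbj≈lj))))

      module _ {i j k} (j≢i : j ≢ i) (k≢j : k ≢ j)
               (ρji≈ki : to (g j ∙ g i) ≈ g k ∙ g i) where

        k≢i : k ≢ i
        k≢i refl = j≢i (first-letter-injective ρji≈ki (to-square i))

        second-letter-image : ∀ {a} → a ≢ i → a ≢ j →
          ∃ λ l → to (g a ∙ g j) ≈ g l ∙ g j × (l ≡ k ⊎ l ≡ i)
        second-letter-image {a} a≢i a≢j with to-neighbour-of-generator j a
        ... | l , ρaj≈lj with l ≟ k | l ≟ i
        ... | yes l≡k | _       = l , ρaj≈lj , inj₁ l≡k
        ... | no _    | yes l≡i = l , ρaj≈lj , inj₂ l≡i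
        ... | no l≢k  | no l≢i  =
          ⊥-elim (no-common-neighbour k≢i k≢j (≢-sym l≢k) (≢-sym j≢i) (≢-sym l≢i) l≢j
            (to-common-neighbour (a , inj₁ ≈-refl) gᵢ-swaps ρji≈ki ρaj≈lj))
          where
          l≢j : l ≢ j
          l≢j refl = a≢j (first-letter-injective ρaj≈lj (to-square j))
          gᵢ-swaps : CayAdj G g (g a ∙ g j) (g a ∙ (g j ∙ g i))
          gᵢ-swaps = i , inj₁ (begin
            g a ∙ (g j ∙ g i)        ≈⟨ sym (assoc _ _ _) ⟩
            (g a ∙ g j) ∙ g i        ≈⟨ sym (identityˡ _) ⟩
            ε ∙ ((g a ∙ g j) ∙ g i)  ≈⟨ sym (swap-gen (commutes-∙ (commutes-other (≢-sym a≢i))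
                                                                   (commutes-other (≢-sym j≢i)))) ⟩
            g i ∙ (g a ∙ g j)        ∎)

      first-letter-fixed : 5 ≤ n → ∀ {i j k} → j ≢ i → to (g j ∙ g i) ≈ g k ∙ g i → k ≡ j
      first-letter-fixed 5≤n {i} {j} {k} j≢i ρji≈ki = decidable-stable (k ≟ j) λ k≢j →
        no-injection-into-pair Image 5≤n i j
          (second-letter-image j≢i k≢j ρji≈ki) first-letter-injective
        where
        Image : Fin n → Fin n → Set
        Image a l = to (g a ∙ g j) ≈ g l ∙ g j

      fixes-product : 5 ≤ n → ∀ i j → to (g j ∙ g i) ≈ g j ∙ g i
      fixes-product 5≤n i j with j ≟ i
      ... | yes refl = to-square i
      ... | no j≢i with to-neighbour-of-generator i j
      ...   | k , ρji≈ki = ≡.subst (λ k → to (g j ∙ g i) ≈ g k ∙ g i)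
                                   (first-letter-fixed 5≤n j≢i ρji≈ki) ρji≈ki

      fixes-distance-two : 5 ≤ n → ∀ {v w} → CayAdj G g ε v → CayAdj G g v w → to w ≈ w
      fixes-distance-two 5≤n {w = w} ε~v v~w with adj⇒left-multiple ε~v | adj⇒left-multiple v~w
      ... | i , v≈gᵢε | j , w≈gⱼv = begin
        to w            ≈⟨ to-cong w≈gⱼgᵢ ⟩
        to (g j ∙ g i)  ≈⟨ fixes-product 5≤n i j ⟩
        g j ∙ g i       ≈⟨ sym w≈gⱼgᵢ ⟩
        w               ∎
        where
        w≈gⱼgᵢ = trans w≈gⱼv (∙-congˡ (trans v≈gᵢε (identityʳ (g i))))

corollary4p1 : (r : ℕ) → 4 ≤ r → (G : Group 0ℓ 0ℓ) → (z : Group.Carrier G) →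
    IsExtraspecial2 G r z →
    (g : Fin (2 * r) → Group.Carrier G) → IsSymmetricBasis G z g →
    (ρ : Inverse (Group.setoid G) (Group.setoid G)) → IsCayAut G g ρ →
    Group._≈_ G (Inverse.to ρ (Group.ε G)) (Group.ε G) →
    (∀ v → CayAdj G g (Group.ε G) v → Group._≈_ G (Inverse.to ρ v) v) →
    ∀ v → CayAdj G g (Group.ε G) v →
      Group._≈_ G (Inverse.to ρ v) v ×
      (∀ w → CayAdj G g v w → Group._≈_ G (Inverse.to ρ w) w)
corollary4p1 r 4≤r G z (_ , centre@(z-central , z≉ε , _) , _) g basis@(_ , g²≈ε , _)
             ρ ρ-aut ρε≈ε ρN≈N v ε~v =
  ρN≈N v ε~v , λ w → fixes-distance-two 5≤2r ε~v
  where
  open Group G using (sym; identityʳ)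
  z²≈ε = centre-involution G centre
  open AnticommutingInvolutions G z-central z≉ε z²≈ε
         g g²≈ε (symmetric-basis-anticommutes G z²≈ε basis)
  open FixingGenerators ρ ρ-aut ρε≈ε (λ i → ρN≈N (g i) (i , inj₁ (sym (identityʳ (g i)))))
  5≤2r : 5 ≤ 2 * r
  5≤2r = ℕ.≤-trans (ℕ.m≤m+n 5 3) (ℕ.*-monoʳ-≤ 2 4≤r)
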